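{- Fix $k\in\mathbb{P}$ and suppose $u,v\in[k,\infty)^*$ are such that there is a rearrangement $f:\mathbb{P}^*\to\mathbb{P}^*$ witnessing $u\sim_s v$. Then for any two words $y,z\in[1,k]^*$ there is a rearrangement $g:\mathbb{P}^*\to\mathbb{P}^*$ witnessing $yuz\sim_s yvz$.
   Context: $\mathbb{P}$ is the positive integers; $\mathbb{P}^*$ the finite words over $\mathbb{P}$; $[k,\infty)^*$ and $[1,k]^*$ are words with all letters in those integer intervals; juxtaposition is concatenation. Generalized factor order: $u\le w$ iff there is a factor $w'$ of $w$ (consecutive letters) with $|w'|=|u|$ and $u_i\le w'_i$ for all $i$; if $w'$ starts at the $j$th letter of $w$, $j$ is an embedding index, and $\mathrm{Em}(u,w)$ is the set of these. The weight of $w=w_1\cdots w_\ell$ is $t^\ell x^{w_1+\cdots+w_\ell}$. A weight-preserving bijection $f:\mathbb{P}^*\to\mathbb{P}^*$ witnesses the strong Wilf equivalence $u\sim_s v$ if $\mathrm{Em}(u,w)=\mathrm{Em}(v,f(w))$ for all $w\in\mathbb{P}^*$. A map $f$ is a rearrangement if $f(w)$ is a permutation of the letters of $w$ for every $w$. -}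

module Defs where

open import Data.Nat using (ℕ; zero; suc; _≤_; _+_)
open import Data.List using (List; []; _∷_; length; drop; take; _++_)
open import Data.Nat.ListAction using (sum)
open import Data.Empty using (⊥)
open import Data.List.Relation.Unary.All using (All)
open import Data.List.Relation.Binary.Pointwise using (Pointwise)
open import Data.List.Relation.Binary.Permutation.Propositional using (_↭_)
open import Data.Product using (_×_; Σ; ∃)
open import Relation.Binary.PropositionalEquality using (_≡_)
open import Function.Bundles using (_⇔_)

-- Letters are natural numbers; a word over ℙ is a list all of whose letters are ≥ 1.
Word : Set
Word = List ℕ

PWord : Word → Set
PWord w = All (λ a → 1 ≤ a) w

AtLeast : ℕ → Word → Set
AtLeast k w = All (λ a → k ≤ a) w

Between1 : ℕ → Word → Set
Between1 k w = All (λ a → 1 ≤ a × a ≤ k) w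

-- j (1-based) is an embedding index of u in w: the factor w' of w starting
-- at the j-th letter has length |u| and u_i ≤ w'_i for all i.
Em : Word → Word → ℕ → Set
Em u w zero    = ⊥
Em u w (suc i) = length u + i ≤ length w × Pointwise _≤_ u (take (length u) (drop i w))

-- weight t^ℓ x^(w_1+...+w_ℓ) is determined by (length, sum)
WeightPreserving : (Word → Word) → Set
WeightPreserving f = ∀ w → PWord w → length (f w) ≡ length w × sum (f w) ≡ sum w

BijectionOnP : (Word → Word) → Set
BijectionOnP f =
  (∀ w → PWord w → PWord (f w)) ×
  (∀ w w' → PWord w → PWord w' → f w ≡ f w' → w ≡ w') ×
  (∀ w' → PWord w' → Σ Word (λ w → PWord w × f w ≡ w'))

Witnesses : (Word → Word) → Word → Word → Set
Witnesses f u v =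
  BijectionOnP f × WeightPreserving f ×
  (∀ w → PWord w → ∀ j → Em u w j ⇔ Em v (f w) j)

Rearrangement : (Word → Word) → Set
Rearrangement f = ∀ w → PWord w → f w ↭ w

-- Cut a word w into maximal factors over [k,∞), separated by letters < k, and let g apply
-- the given rearrangement f to each factor while fixing the separators.  An occurrence of u
-- or v (letters ≥ k) can never cover a separator, so it lies inside one factor, where f
-- transports it.  The letters of y and z are ≤ k, and g only permutes letters ≥ k among
-- themselves inside factors, so each position of g w is ≥ k exactly when that of w is and
-- otherwise carries the same letter; hence y and z dominate the same positions of w and g w.
module Submission where

open import Defs
open import Data.Nat using (ℕ; zero; suc; _+_; _≤_; _<_; z≤n; s≤s; s≤s⁻¹; _≤?_)
open import Data.Nat.Properties using (≤-refl; ≤-trans; ≤-antisym; <⇒≱; ≰⇒>; +-suc; +-identityʳ; suc-injective)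
open import Data.Nat.ListAction.Properties using (sum-↭)
open import Data.List using (_∷_; []; _++_; [_]; length; take)
open import Data.List.Properties using (++-assoc; ++-identityʳ)
open import Data.List.Relation.Unary.All as All using (All; []; _∷_; all?)
open import Data.List.Relation.Unary.All.Properties using (++⁺)
import Data.List.Relation.Binary.Pointwise as Pointwise
open Pointwise using (Pointwise; []; _∷_)
open import Data.List.Relation.Binary.Permutation.Propositional using (_↭_; prep; ↭-sym; ↭-trans)
open import Data.List.Relation.Binary.Permutation.Propositional.Properties
  using (All-resp-↭; ↭-length; ++⁺ˡ; ++⁺ʳ)
open import Data.Empty using (⊥; ⊥-elim)
open import Data.Unit using (⊤; tt)
open import Data.Sum using (_⊎_; inj₁; inj₂)
open import Data.Product using (_×_; _,_; proj₁; proj₂; Σ; ∃)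
open import Data.Product.Function.NonDependent.Propositional using (_×-⇔_)
open import Function using (id)
open import Function.Bundles using (_⇔_; mk⇔; Equivalence)
open import Function.Construct.Symmetry using (⇔-sym)
open import Function.Related.Propositional as Related using ()
open import Relation.Binary.PropositionalEquality using (_≡_; refl; sym; trans; cong; cong₂; subst; module ≡-Reasoning)
open import Relation.Nullary using (¬_; yes; no)

infix 4 _≼_ _≼⟨_⟩_

_≼_ : Word → Word → Set
[]      ≼ W       = ⊤
(c ∷ u) ≼ []      = ⊥
(c ∷ u) ≼ (x ∷ W) = c ≤ x × u ≼ W

-- The position i is 0-based, whereas Em counts from 1 (Em⇔≼⟨⟩).
_≼⟨_⟩_ : Word → ℕ → Word → Set
u ≼⟨ zero  ⟩ W       = u ≼ W
u ≼⟨ suc i ⟩ []      = ⊥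
u ≼⟨ suc i ⟩ (x ∷ W) = u ≼⟨ i ⟩ W

≼⇔pointwise-take : ∀ u W → u ≼ W ⇔ (length u ≤ length W × Pointwise _≤_ u (take (length u) W))
≼⇔pointwise-take []      W       = mk⇔ (λ _ → z≤n , []) (λ _ → tt)
≼⇔pointwise-take (c ∷ u) []      = mk⇔ (λ ()) (λ { (() , _) })
≼⇔pointwise-take (c ∷ u) (x ∷ W) = mk⇔
  (λ (c≤x , u≼W) → let (l , p) = to u≼W in s≤s l , c≤x ∷ p)
  (λ { (s≤s l , c≤x ∷ p) → c≤x , from (l , p) })
  where open Equivalence (≼⇔pointwise-take u W)

Em⇔≼⟨⟩ : ∀ u W i → Em u W (suc i) ⇔ u ≼⟨ i ⟩ W
Em⇔≼⟨⟩ u W zero rewrite +-identityʳ (length u) = ⇔-sym (≼⇔pointwise-take u W)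
Em⇔≼⟨⟩ u [] (suc i) rewrite +-suc (length u) i = mk⇔ (λ { (() , _) }) (λ ())
Em⇔≼⟨⟩ u (x ∷ W) (suc i) rewrite +-suc (length u) i = mk⇔
  (λ (l , p) → to (s≤s⁻¹ l , p))
  (λ p → let (l , q) = from p in s≤s l , q)
  where open Equivalence (Em⇔≼⟨⟩ u W i)

≼-refl : ∀ u → u ≼ u
≼-refl []      = tt
≼-refl (c ∷ u) = ≤-refl , ≼-refl u

≼⇒length≤ : ∀ u W → u ≼ W → length u ≤ length W
≼⇒length≤ []      W       _       = z≤n
≼⇒length≤ (c ∷ u) (x ∷ W) (_ , p) = s≤s (≼⇒length≤ u W p)

≼-++ : ∀ p q W → p ++ q ≼ W ⇔ (p ≼ W × q ≼⟨ length p ⟩ W)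
≼-++ []      q W       = mk⇔ (tt ,_) proj₂
≼-++ (c ∷ p) q []      = mk⇔ (λ ()) (λ { (() , _) })
≼-++ (c ∷ p) q (x ∷ W) = mk⇔
  (λ (c≤x , r) → let (s , t) = to r in (c≤x , s) , t)
  (λ ((c≤x , s) , t) → c≤x , from (s , t))
  where open Equivalence (≼-++ p q W)

≼⟨⟩-++ : ∀ p q i W → p ++ q ≼⟨ i ⟩ W ⇔ (p ≼⟨ i ⟩ W × q ≼⟨ i + length p ⟩ W)
≼⟨⟩-++ p q zero    W       = ≼-++ p q W
≼⟨⟩-++ p q (suc i) []      = mk⇔ (λ ()) (λ { (() , _) })
≼⟨⟩-++ p q (suc i) (x ∷ W) = ≼⟨⟩-++ p q i W

≼-++ʳ : ∀ u W V → u ≼ W → u ≼ W ++ V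
≼-++ʳ []      W       V _         = tt
≼-++ʳ (c ∷ u) (x ∷ W) V (c≤x , p) = c≤x , ≼-++ʳ u W V p

≼⟨⟩-++ʳ : ∀ u i W V → u ≼⟨ i ⟩ W → u ≼⟨ i ⟩ W ++ V
≼⟨⟩-++ʳ u zero    W       V p = ≼-++ʳ u W V p
≼⟨⟩-++ʳ u (suc i) (x ∷ W) V p = ≼⟨⟩-++ʳ u i W V p

≼⟨⟩-shift : ∀ u j X a Y → u ≼⟨ j ⟩ Y → u ≼⟨ suc (length X + j) ⟩ X ++ a ∷ Y
≼⟨⟩-shift u j []      a Y p = p
≼⟨⟩-shift u j (x ∷ X) a Y p = ≼⟨⟩-shift u j X a Y p

atLeast⇒PWord : ∀ {k w} → 1 ≤ k → AtLeast k w → PWord w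
atLeast⇒PWord 1≤k = All.map (≤-trans 1≤k)

rearrangement-All : ∀ {f} {P : ℕ → Set} {w} → Rearrangement f → PWord w → All P w → All P (f w)
rearrangement-All f-↭ w∈ℙ* = All-resp-↭ (↭-sym (f-↭ _ w∈ℙ*))

rearrangement⇒weightPreserving : ∀ {f} → Rearrangement f → WeightPreserving f
rearrangement⇒weightPreserving f-↭ w w∈ℙ* = ↭-length (f-↭ w w∈ℙ*) , sum-↭ (f-↭ w w∈ℙ*)

witnesses⇒length≡ : ∀ {f u v} → Witnesses f u v → PWord u → PWord v → length u ≡ length v
witnesses⇒length≡ {f} {u} {v} ((_ , _ , f-surj) , f-weight , f-em) u∈ℙ* v∈ℙ* =
  ≤-antisym |u|≤|v| |v|≤|u|
  where
  v≼fu : v ≼ f u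
  v≼fu = Equivalence.to (Em⇔≼⟨⟩ v (f u) 0)
           (Equivalence.to (f-em u u∈ℙ* 1) (Equivalence.from (Em⇔≼⟨⟩ u u 0) (≼-refl u)))

  |v|≤|u| : length v ≤ length u
  |v|≤|u| = subst (length v ≤_) (proj₁ (f-weight u u∈ℙ*)) (≼⇒length≤ v (f u) v≼fu)

  |u|≤|v| : length u ≤ length v
  |u|≤|v| with f-surj v v∈ℙ*
  ... | w , w∈ℙ* , refl = subst (length u ≤_) (sym (proj₁ (f-weight w w∈ℙ*))) (≼⇒length≤ u w u≼w)
    where
    u≼w : u ≼ w
    u≼w = Equivalence.to (Em⇔≼⟨⟩ u w 0)
            (Equivalence.from (f-em w w∈ℙ* 1) (Equivalence.from (Em⇔≼⟨⟩ v (f w) 0) (≼-refl (f w))))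

module _ {f : Word → Word} (f-bij : BijectionOnP f) where

  private
    f-surj : ∀ w → PWord w → Σ Word (λ w′ → PWord w′ × f w′ ≡ w)
    f-surj = proj₂ (proj₂ f-bij)

  inverse : Word → Word
  inverse w with all? (1 ≤?_) w
  ... | yes w∈ℙ* = proj₁ (f-surj w w∈ℙ*)
  ... | no  _    = w

  inverse-spec : ∀ w → PWord w → PWord (inverse w) × f (inverse w) ≡ w
  inverse-spec w w∈ℙ* with all? (1 ≤?_) w
  ... | yes w∈ℙ*′ = proj₂ (f-surj w w∈ℙ*′)
  ... | no  w∉ℙ*  = ⊥-elim (w∉ℙ* w∈ℙ*)

  inverse-f : ∀ w → PWord w → inverse (f w) ≡ w
  inverse-f w w∈ℙ* with inverse-spec (f w) (proj₁ f-bij w w∈ℙ*)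
  ... | inv∈ℙ* , f-inv = proj₁ (proj₂ f-bij) (inverse (f w)) w inv∈ℙ* w∈ℙ* f-inv

  inverse-↭ : Rearrangement f → Rearrangement inverse
  inverse-↭ f-↭ w w∈ℙ* with inverse-spec w w∈ℙ*
  ... | inv∈ℙ* , f-inv = ↭-sym (subst (_↭ inverse w) f-inv (f-↭ (inverse w) inv∈ℙ*))

module Blocks (k : ℕ) where

  -- No letter ≤ k distinguishes two letters that Agree.
  Agree : ℕ → ℕ → Set
  Agree a b = (k ≤ a × k ≤ b) ⊎ a ≡ b

  Agree-sym : ∀ {a b} → Agree a b → Agree b a
  Agree-sym (inj₁ (k≤a , k≤b)) = inj₁ (k≤b , k≤a)
  Agree-sym (inj₂ a≡b)         = inj₂ (sym a≡b)

  atLeast-agree : ∀ {X X'} → AtLeast k X → AtLeast k X' → length X ≡ length X' →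
                  Pointwise Agree X X'
  atLeast-agree []           []             _     = []
  atLeast-agree (k≤x ∷ X≥k) (k≤x' ∷ X'≥k) |X|≡ =
    inj₁ (k≤x , k≤x') ∷ atLeast-agree X≥k X'≥k (suc-injective |X|≡)

  ≼-agree : ∀ {W W'} y → All (_≤ k) y → Pointwise Agree W W' → y ≼ W → y ≼ W'
  ≼-agree []      _             _                      _         = tt
  ≼-agree (c ∷ y) (c≤k ∷ y≤k) (inj₁ (_ , k≤x') ∷ rs) (_ , p)   = ≤-trans c≤k k≤x' , ≼-agree y y≤k rs p
  ≼-agree (c ∷ y) (_ ∷ y≤k)   (inj₂ refl ∷ rs)       (c≤x , p) = c≤x , ≼-agree y y≤k rs p

  ≼⟨⟩-agree : ∀ {W W'} y i → All (_≤ k) y → Pointwise Agree W W' → y ≼⟨ i ⟩ W → y ≼⟨ i ⟩ W'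
  ≼⟨⟩-agree y zero    y≤k rs       = ≼-agree y y≤k rs
  ≼⟨⟩-agree y (suc i) y≤k (_ ∷ rs) = ≼⟨⟩-agree y i y≤k rs

  ≼⟨⟩-agree⇔ : ∀ {W W'} y i → All (_≤ k) y → Pointwise Agree W W' → y ≼⟨ i ⟩ W ⇔ y ≼⟨ i ⟩ W'
  ≼⟨⟩-agree⇔ y i y≤k rs =
    mk⇔ (≼⟨⟩-agree y i y≤k rs) (≼⟨⟩-agree y i y≤k (Pointwise.symmetric Agree-sym rs))

  ≼-before : ∀ u X {a Y} → AtLeast k u → a < k → u ≼ X ++ a ∷ Y → u ≼ X
  ≼-before []      X       _           _   _         = tt
  ≼-before (c ∷ u) []      (k≤c ∷ _)   a<k (c≤a , _) = ⊥-elim (<⇒≱ a<k (≤-trans k≤c c≤a))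
  ≼-before (c ∷ u) (x ∷ X) (_ ∷ u≥k)  a<k (c≤x , p) = c≤x , ≼-before u X u≥k a<k p

  ≼⟨⟩-split : ∀ u i X {a Y} → AtLeast k u → a < k → u ≼⟨ i ⟩ X ++ a ∷ Y →
              u ≼⟨ i ⟩ X ⊎ ∃ λ j → i ≡ suc (length X + j) × u ≼⟨ j ⟩ Y
  ≼⟨⟩-split u zero    X       u≥k a<k p = inj₁ (≼-before u X u≥k a<k p)
  ≼⟨⟩-split u (suc i) []      u≥k a<k p = inj₂ (i , refl , p)
  ≼⟨⟩-split u (suc i) (x ∷ X) u≥k a<k p with ≼⟨⟩-split u i X u≥k a<k p
  ... | inj₁ q           = inj₁ q
  ... | inj₂ (j , i≡ , q) = inj₂ (j , cong suc i≡ , q)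

  ≼⟨⟩-transfer : ∀ u v X X' a Y Y' → AtLeast k u → a < k → length X ≡ length X' →
    (∀ i → u ≼⟨ i ⟩ X → v ≼⟨ i ⟩ X') → (∀ i → u ≼⟨ i ⟩ Y → v ≼⟨ i ⟩ Y') →
    ∀ i → u ≼⟨ i ⟩ X ++ a ∷ Y → v ≼⟨ i ⟩ X' ++ a ∷ Y'
  ≼⟨⟩-transfer u v X X' a Y Y' u≥k a<k |X|≡ onX onY i p with ≼⟨⟩-split u i X u≥k a<k p
  ... | inj₁ q              = ≼⟨⟩-++ʳ v i X' (a ∷ Y') (onX i q)
  ... | inj₂ (j , refl , q) rewrite |X|≡ = ≼⟨⟩-shift v j X' a Y' (onY j q)

  -- F is applied to each maximal factor over [k,∞); acc is the part of the current factor
  -- already read.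
  mapBlocksFrom : (Word → Word) → Word → Word → Word
  mapBlocksFrom F acc []      = F acc
  mapBlocksFrom F acc (a ∷ w) with k ≤? a
  ... | yes _ = mapBlocksFrom F (acc ++ [ a ]) w
  ... | no  _ = F acc ++ a ∷ mapBlocksFrom F [] w

  mapBlocks : (Word → Word) → Word → Word
  mapBlocks F = mapBlocksFrom F []

  mapBlocksFrom-separator : ∀ F acc {a} w → ¬ k ≤ a →
                            mapBlocksFrom F acc (a ∷ w) ≡ F acc ++ a ∷ mapBlocks F w
  mapBlocksFrom-separator F acc {a} w k≰a with k ≤? a
  ... | yes k≤a = ⊥-elim (k≰a k≤a)
  ... | no  _   = refl

  mapBlocksFrom-++ : ∀ F acc X w → AtLeast k X → mapBlocksFrom F acc (X ++ w) ≡ mapBlocksFrom F (acc ++ X) w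
  mapBlocksFrom-++ F acc []      w _ = cong (λ acc → mapBlocksFrom F acc w) (sym (++-identityʳ acc))
  mapBlocksFrom-++ F acc (x ∷ X) w (k≤x ∷ X≥k) with k ≤? x
  ... | yes _   = trans (mapBlocksFrom-++ F (acc ++ [ x ]) X w X≥k)
                        (cong (λ acc → mapBlocksFrom F acc w) (++-assoc acc [ x ] X))
  ... | no  k≰x = ⊥-elim (k≰x k≤x)

  mapBlocks-block : ∀ F X → AtLeast k X → mapBlocks F X ≡ F X
  mapBlocks-block F X X≥k = trans (cong (mapBlocks F) (sym (++-identityʳ X))) (mapBlocksFrom-++ F [] X [] X≥k)

  private
    extend : ∀ {acc a} → AtLeast k acc → k ≤ a → AtLeast k (acc ++ [ a ])
    extend acc≥k k≤a = ++⁺ acc≥k (k≤a ∷ [])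

  mapBlocksFrom-↭ : ∀ F → (∀ acc → AtLeast k acc → F acc ↭ acc) →
                    ∀ acc w → AtLeast k acc → mapBlocksFrom F acc w ↭ acc ++ w
  mapBlocksFrom-↭ F F-↭ acc [] acc≥k rewrite ++-identityʳ acc = F-↭ acc acc≥k
  mapBlocksFrom-↭ F F-↭ acc (a ∷ w) acc≥k with k ≤? a
  ... | yes k≤a = subst (mapBlocksFrom F (acc ++ [ a ]) w ↭_) (++-assoc acc [ a ] w)
                        (mapBlocksFrom-↭ F F-↭ (acc ++ [ a ]) w (extend acc≥k k≤a))
  ... | no  _   = ↭-trans (++⁺ʳ (a ∷ mapBlocks F w) (F-↭ acc acc≥k))
                          (++⁺ˡ acc (prep a (mapBlocksFrom-↭ F F-↭ [] w [])))

  mapBlocksFrom-inverse : ∀ F G → (∀ acc → AtLeast k acc → AtLeast k (F acc)) →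
    (∀ acc → AtLeast k acc → G (F acc) ≡ acc) →
    ∀ acc w → AtLeast k acc → mapBlocks G (mapBlocksFrom F acc w) ≡ acc ++ w
  mapBlocksFrom-inverse F G F≥k GF acc [] acc≥k = begin
    mapBlocks G (F acc) ≡⟨ mapBlocks-block G (F acc) (F≥k acc acc≥k) ⟩
    G (F acc)           ≡⟨ GF acc acc≥k ⟩
    acc                 ≡⟨ ++-identityʳ acc ⟨
    acc ++ []           ∎
    where open ≡-Reasoning
  mapBlocksFrom-inverse F G F≥k GF acc (a ∷ w) acc≥k with k ≤? a
  ... | yes k≤a = trans (mapBlocksFrom-inverse F G F≥k GF (acc ++ [ a ]) w (extend acc≥k k≤a))
                        (++-assoc acc [ a ] w)
  ... | no  k≰a = begin
    mapBlocks G (F acc ++ a ∷ mapBlocks F w)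
      ≡⟨ mapBlocksFrom-++ G [] (F acc) (a ∷ mapBlocks F w) (F≥k acc acc≥k) ⟩
    mapBlocksFrom G (F acc) (a ∷ mapBlocks F w)
      ≡⟨ mapBlocksFrom-separator G (F acc) (mapBlocks F w) k≰a ⟩
    G (F acc) ++ a ∷ mapBlocks G (mapBlocks F w)
      ≡⟨ cong₂ (λ p q → p ++ a ∷ q) (GF acc acc≥k) (mapBlocksFrom-inverse F G F≥k GF [] w []) ⟩
    acc ++ a ∷ w
      ∎
    where open ≡-Reasoning

  module _ {F : Word → Word}
           (F≥k : ∀ acc → AtLeast k acc → AtLeast k (F acc))
           (F-length : ∀ acc → AtLeast k acc → length (F acc) ≡ length acc) where

    mapBlocksFrom-agree : ∀ acc w → AtLeast k acc → Pointwise Agree (acc ++ w) (mapBlocksFrom F acc w)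
    mapBlocksFrom-agree acc [] acc≥k rewrite ++-identityʳ acc =
      atLeast-agree acc≥k (F≥k acc acc≥k) (sym (F-length acc acc≥k))
    mapBlocksFrom-agree acc (a ∷ w) acc≥k with k ≤? a
    ... | yes k≤a = subst (λ W → Pointwise Agree W (mapBlocksFrom F (acc ++ [ a ]) w)) (++-assoc acc [ a ] w)
                          (mapBlocksFrom-agree (acc ++ [ a ]) w (extend acc≥k k≤a))
    ... | no  _   = Pointwise.++⁺ (atLeast-agree acc≥k (F≥k acc acc≥k) (sym (F-length acc acc≥k)))
                                  (inj₂ refl ∷ mapBlocksFrom-agree [] w [])

    module _ {u v : Word} (u≥k : AtLeast k u) (v≥k : AtLeast k v)
             (F-≼ : ∀ acc → AtLeast k acc → ∀ i → u ≼⟨ i ⟩ acc ⇔ v ≼⟨ i ⟩ F acc) where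

      mapBlocksFrom-≼ : ∀ acc w → AtLeast k acc → ∀ i →
                        u ≼⟨ i ⟩ acc ++ w ⇔ v ≼⟨ i ⟩ mapBlocksFrom F acc w
      mapBlocksFrom-≼ acc [] acc≥k i rewrite ++-identityʳ acc = F-≼ acc acc≥k i
      mapBlocksFrom-≼ acc (a ∷ w) acc≥k i with k ≤? a
      ... | yes k≤a = subst (λ W → u ≼⟨ i ⟩ W ⇔ v ≼⟨ i ⟩ mapBlocksFrom F (acc ++ [ a ]) w)
                            (++-assoc acc [ a ] w)
                            (mapBlocksFrom-≼ (acc ++ [ a ]) w (extend acc≥k k≤a) i)
      ... | no  k≰a = mk⇔
        (≼⟨⟩-transfer u v acc (F acc) a w (mapBlocks F w) u≥k a<k (sym |F|≡)
          (λ j → Equivalence.to (F-≼ acc acc≥k j)) (λ j → Equivalence.to (rest j)) i)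
        (≼⟨⟩-transfer v u (F acc) acc a (mapBlocks F w) w v≥k a<k |F|≡
          (λ j → Equivalence.from (F-≼ acc acc≥k j)) (λ j → Equivalence.from (rest j)) i)
        where
        a<k : a < k
        a<k = ≰⇒> k≰a
        |F|≡ : length (F acc) ≡ length acc
        |F|≡ = F-length acc acc≥k
        rest : ∀ j → u ≼⟨ j ⟩ w ⇔ v ≼⟨ j ⟩ mapBlocks F w
        rest = mapBlocksFrom-≼ [] w []

module _ {k : ℕ} (1≤k : 1 ≤ k) {f : Word → Word}
         (f-↭ : Rearrangement f) (f-bij : BijectionOnP f) where

  open Blocks k

  private
    f≥k : ∀ acc → AtLeast k acc → AtLeast k (f acc)
    f≥k acc acc≥k = rearrangement-All f-↭ (atLeast⇒PWord 1≤k acc≥k) acc≥k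

    f⁻¹≥k : ∀ acc → AtLeast k acc → AtLeast k (inverse f-bij acc)
    f⁻¹≥k acc acc≥k = rearrangement-All (inverse-↭ f-bij f-↭) (atLeast⇒PWord 1≤k acc≥k) acc≥k

    f-length : ∀ acc → AtLeast k acc → length (f acc) ≡ length acc
    f-length acc acc≥k = ↭-length (f-↭ acc (atLeast⇒PWord 1≤k acc≥k))

  mapBlocks-↭ : Rearrangement (mapBlocks f)
  mapBlocks-↭ w _ = mapBlocksFrom-↭ f (λ acc acc≥k → f-↭ acc (atLeast⇒PWord 1≤k acc≥k)) [] w []

  mapBlocks-bijection : BijectionOnP (mapBlocks f)
  mapBlocks-bijection =
    (λ w w∈ℙ* → rearrangement-All mapBlocks-↭ w∈ℙ* w∈ℙ*) ,
    (λ w w' _ _ gw≡gw' → begin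
      w                                  ≡⟨ left-inverse w ⟨
      mapBlocks f⁻¹ (mapBlocks f w)      ≡⟨ cong (mapBlocks f⁻¹) gw≡gw' ⟩
      mapBlocks f⁻¹ (mapBlocks f w')     ≡⟨ left-inverse w' ⟩
      w'                                 ∎) ,
    (λ w' w'∈ℙ* →
      mapBlocks f⁻¹ w' ,
      All-resp-↭ (↭-sym (mapBlocksFrom-↭ f⁻¹ f⁻¹-↭ [] w' [])) w'∈ℙ* ,
      mapBlocksFrom-inverse f⁻¹ f f⁻¹≥k
        (λ acc acc≥k → proj₂ (inverse-spec f-bij acc (atLeast⇒PWord 1≤k acc≥k))) [] w' [])
    where
    open ≡-Reasoning
    f⁻¹ : Word → Word
    f⁻¹ = inverse f-bij

    f⁻¹-↭ : ∀ acc → AtLeast k acc → f⁻¹ acc ↭ acc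
    f⁻¹-↭ acc acc≥k = inverse-↭ f-bij f-↭ acc (atLeast⇒PWord 1≤k acc≥k)

    left-inverse : ∀ w → mapBlocks f⁻¹ (mapBlocks f w) ≡ w
    left-inverse w = mapBlocksFrom-inverse f f⁻¹ f≥k
      (λ acc acc≥k → inverse-f f-bij acc (atLeast⇒PWord 1≤k acc≥k)) [] w []

  mapBlocks-≼-infix : ∀ {u v y z} → Witnesses f u v → AtLeast k u → AtLeast k v →
    All (_≤ k) y → All (_≤ k) z →
    ∀ w i → y ++ u ++ z ≼⟨ i ⟩ w ⇔ y ++ v ++ z ≼⟨ i ⟩ mapBlocks f w
  mapBlocks-≼-infix {u} {v} {y} {z} f-wit@(_ , _ , f-em) u≥k v≥k y≤k z≤k w i = begin
    y ++ u ++ z ≼⟨ i ⟩ w                    ∼⟨ ≼⟨⟩-++ y (u ++ z) i w ⟩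
    (y ≼⟨ i ⟩ w × u ++ z ≼⟨ j ⟩ w)         ∼⟨ ≼⟨⟩-agree⇔ y i y≤k agree ×-⇔ u++z⇔v++z ⟩
    (y ≼⟨ i ⟩ g w × v ++ z ≼⟨ j ⟩ g w)     ∼⟨ ⇔-sym (≼⟨⟩-++ y (v ++ z) i (g w)) ⟩
    y ++ v ++ z ≼⟨ i ⟩ g w                  ∎
    where
    open Related.EquationalReasoning
    g : Word → Word
    g = mapBlocks f
    j : ℕ
    j = i + length y
    agree : Pointwise Agree w (g w)
    agree = mapBlocksFrom-agree f≥k f-length [] w []

    f-≼ : ∀ acc → AtLeast k acc → ∀ j → u ≼⟨ j ⟩ acc ⇔ v ≼⟨ j ⟩ f acc
    f-≼ acc acc≥k j = begin
      u ≼⟨ j ⟩ acc         ∼⟨ ⇔-sym (Em⇔≼⟨⟩ u acc j) ⟩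
      Em u acc (suc j)     ∼⟨ f-em acc (atLeast⇒PWord 1≤k acc≥k) (suc j) ⟩
      Em v (f acc) (suc j) ∼⟨ Em⇔≼⟨⟩ v (f acc) j ⟩
      v ≼⟨ j ⟩ f acc       ∎

    |u|≡|v| : length u ≡ length v
    |u|≡|v| = witnesses⇒length≡ f-wit (atLeast⇒PWord 1≤k u≥k) (atLeast⇒PWord 1≤k v≥k)

    u++z⇔v++z : u ++ z ≼⟨ j ⟩ w ⇔ v ++ z ≼⟨ j ⟩ g w
    u++z⇔v++z = begin
      u ++ z ≼⟨ j ⟩ w
        ∼⟨ ≼⟨⟩-++ u z j w ⟩
      (u ≼⟨ j ⟩ w × z ≼⟨ j + length u ⟩ w)
        ∼⟨ mapBlocksFrom-≼ f≥k f-length u≥k v≥k f-≼ [] w [] j ×-⇔ ≼⟨⟩-agree⇔ z (j + length u) z≤k agree ⟩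
      (v ≼⟨ j ⟩ g w × z ≼⟨ j + length u ⟩ g w)
        ≡⟨ cong (λ n → v ≼⟨ j ⟩ g w × z ≼⟨ j + n ⟩ g w) |u|≡|v| ⟩
      (v ≼⟨ j ⟩ g w × z ≼⟨ j + length v ⟩ g w)
        ∼⟨ ⇔-sym (≼⟨⟩-++ v z j (g w)) ⟩
      v ++ z ≼⟨ j ⟩ g w
        ∎

theorem5p4 : (k : ℕ) → 1 ≤ k → (u v : Word) → AtLeast k u → AtLeast k v →
    Σ (Word → Word) (λ f → Rearrangement f × Witnesses f u v) →
    (y z : Word) → Between1 k y → Between1 k z →
    Σ (Word → Word) (λ g → Rearrangement g × Witnesses g (y ++ u ++ z) (y ++ v ++ z))
theorem5p4 k 1≤k u v u≥k v≥k (f , f-↭ , f-wit@(f-bij , _)) y z y∈ z∈ =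
  mapBlocks f ,
  g-↭ ,
  mapBlocks-bijection 1≤k f-↭ f-bij , rearrangement⇒weightPreserving g-↭ , g-em
  where
  open Blocks k
  g-↭ : Rearrangement (mapBlocks f)
  g-↭ = mapBlocks-↭ 1≤k f-↭ f-bij

  g-em : ∀ w → PWord w → ∀ j → Em (y ++ u ++ z) w j ⇔ Em (y ++ v ++ z) (mapBlocks f w) j
  g-em w _ zero    = mk⇔ id id
  g-em w _ (suc i) = begin
    Em (y ++ u ++ z) w (suc i)             ∼⟨ Em⇔≼⟨⟩ (y ++ u ++ z) w i ⟩
    y ++ u ++ z ≼⟨ i ⟩ w                   ∼⟨ mapBlocks-≼-infix 1≤k f-↭ f-bij f-wit u≥k v≥k
                                                (All.map proj₂ y∈) (All.map proj₂ z∈) w i ⟩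
    y ++ v ++ z ≼⟨ i ⟩ mapBlocks f w       ∼⟨ ⇔-sym (Em⇔≼⟨⟩ (y ++ v ++ z) (mapBlocks f w) i) ⟩
    Em (y ++ v ++ z) (mapBlocks f w) (suc i) ∎
    where open Related.EquationalReasoning
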